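{- Let $(S,\mathcal{U})$ be a composable map with unique cores, and let $\sigma_1,\sigma_2\in S(2^{\mathcal{U}})$ with $\sigma_1\succ\sigma_2$. Then $\mathrm{core}(\sigma_1)\cap\mathrm{MaxSet}(\sigma_2)\subseteq\mathrm{core}(\sigma_2)$.
   Context: Composable map: finite $\mathcal{U}$, $S:2^{\mathcal{U}}\to\Sigma$, binary operation $\oplus$ with $S(U\cup V)=S(U)\oplus S(V)$. A core of $\sigma$ is an inclusion-minimal set with sketch $\sigma$; the map has unique cores if every sketch $\sigma$ has exactly one core, denoted $\mathrm{core}(\sigma)$. $\mathrm{MaxSet}(\sigma)=\bigcup\{V:S(V)=\sigma\}$. $\sigma_1\succ\sigma_2$ means $\mathrm{MaxSet}(\sigma_2)\subseteq\mathrm{MaxSet}(\sigma_1)$. -}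

module Defs where

open import Data.Nat using (ℕ)
open import Data.Fin using (Fin)
open import Data.Fin.Subset using (Subset; _∈_; _⊆_; _∪_; _∩_)
open import Data.Product using (Σ; ∃; _×_; _,_)
open import Relation.Binary.PropositionalEquality using (_≡_)

record ComposableMap (n : ℕ) (Sk : Set) : Set where
  field
    S   : Subset n → Sk
    _⊕_ : Sk → Sk → Sk
    composable : ∀ U V → S (U ∪ V) ≡ S U ⊕ S V

module _ {n : ℕ} {Sk : Set} (M : ComposableMap n Sk) where
  open ComposableMap M

  IsSketch : Sk → Set
  IsSketch σ = ∃ λ V → S V ≡ σ

  IsCore : Sk → Subset n → Set
  IsCore σ C = (S C ≡ σ) × (∀ V → V ⊆ C → S V ≡ σ → V ≡ C)

  HasUniqueCores : Set
  HasUniqueCores = ∀ σ → IsSketch σ →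
    ∃ λ C → IsCore σ C × (∀ C' → IsCore σ C' → C' ≡ C)

  MaxSet : Sk → Fin n → Set
  MaxSet σ x = ∃ λ V → (S V ≡ σ) × (x ∈ V)

  _≻_ : Sk → Sk → Set
  σ₁ ≻ σ₂ = ∀ x → MaxSet σ₂ x → MaxSet σ₁ x

-- Since σ₁ ≻ σ₂ and sets of a common sketch are closed under union, some set A of sketch σ₁
-- contains a set V₂ ∋ x of sketch σ₂. If x ∉ C₂, exchanging V₂ for C₂ inside A gives the set
-- (A ─ V₂) ∪ C₂, still of sketch σ₁ but without x. Under unique cores, however, every set of
-- sketch σ contains a minimal one, which must be the core of σ; so x ∈ C₁ forces x into that set.
module Submission where

open import Defs
open import Data.Nat using (ℕ; _<_)
open import Data.Nat.Induction using (<-wellFounded)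
open import Data.Fin using (Fin; zero; suc)
open import Data.Fin.Subset
open import Data.Fin.Subset.Properties
open import Data.Vec using (_∷_; here; there)
open import Data.List using (List; []; _∷_; allFin)
open import Data.List.Membership.Propositional using () renaming (_∈_ to _∈ₗ_)
open import Data.List.Membership.Propositional.Properties using (∈-allFin)
import Data.List.Relation.Unary.Any as Any
open import Data.Product using (∃; _×_; _,_; proj₁)
open import Data.Sum using (_⊎_; inj₁; inj₂; [_,_]′)
open import Function using (_∘_)
open import Induction.WellFounded using (Acc; acc)
open import Relation.Nullary using (¬_; Dec; yes; no; contradiction)
open import Relation.Nullary.Decidable using (decidable-stable; ¬¬-excluded-middle)
open import Relation.Binary.PropositionalEquality

x∈p─q⇒x∉q : ∀ {n} {p q : Subset n} {x : Fin n} → x ∈ p ─ q → x ∉ q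
x∈p─q⇒x∉q {p = _ ∷ _} {q = _ ∷ _} {zero}  ()          here
x∈p─q⇒x∉q {p = _ ∷ _} {q = _ ∷ _} {suc x} (there x∈p─q) (there x∈q) = x∈p─q⇒x∉q x∈p─q x∈q

p⊆q⇒q─p∪p≡q : ∀ {n} {p q : Subset n} → p ⊆ q → (q ─ p) ∪ p ≡ q
p⊆q⇒q─p∪p≡q {p = p} {q} p⊆q = ⊆-antisym
  ([ p─q⊆p q p , p⊆q ]′ ∘ x∈p∪q⁻ (q ─ p) p)
  (λ {x} x∈q → x∈p∪q⁺ (split x∈q (x ∈? p)))
  where
  split : ∀ {x} → x ∈ q → Dec (x ∈ p) → x ∈ q ─ p ⊎ x ∈ p
  split x∈q (yes x∈p) = inj₂ x∈p
  split x∈q (no x∉p)  = inj₁ (x∈p∧x∉q⇒x∈p─q x∈q x∉p)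

p⊆q∧p⊄q⇒p≡q : ∀ {n} {p q : Subset n} → p ⊆ q → ¬ (p ⊂ q) → p ≡ q
p⊆q∧p⊄q⇒p≡q {p = p} p⊆q p⊄q = ⊆-antisym p⊆q λ {x} x∈q →
  decidable-stable (x ∈? p) (λ x∉p → p⊄q (p⊆q , x , x∈q , x∉p))

module _ {n : ℕ} {Sk : Set} (M : ComposableMap n Sk) where
  open ComposableMap M

  ∪-preserves-S : ∀ {σ U V} → S U ≡ σ → S V ≡ σ → S (U ∪ V) ≡ σ
  ∪-preserves-S {σ} {U} {V} SU≡σ SV≡σ = begin
    S (U ∪ V)  ≡⟨ composable U V ⟩
    S U ⊕ S V  ≡⟨ cong (S U ⊕_) (trans SV≡σ (sym SU≡σ)) ⟩
    S U ⊕ S U  ≡⟨ composable U U ⟨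
    S (U ∪ U)  ≡⟨ cong S (∪-idem U) ⟩
    S U        ≡⟨ SU≡σ ⟩
    σ          ∎
    where open ≡-Reasoning

  S-replace : ∀ {A V C} → V ⊆ A → S V ≡ S C → S ((A ─ V) ∪ C) ≡ S A
  S-replace {A} {V} {C} V⊆A SV≡SC = begin
    S ((A ─ V) ∪ C)  ≡⟨ composable (A ─ V) C ⟩
    S (A ─ V) ⊕ S C  ≡⟨ cong (S (A ─ V) ⊕_) SV≡SC ⟨
    S (A ─ V) ⊕ S V  ≡⟨ composable (A ─ V) V ⟨
    S ((A ─ V) ∪ V)  ≡⟨ cong S (p⊆q⇒q─p∪p≡q V⊆A) ⟩
    S A              ∎
    where open ≡-Reasoning

  ⊆MaxSet⇒⊆S⁻¹ : ∀ {σ V} → IsSketch M σ → (∀ {x} → x ∈ V → MaxSet M σ x)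
    → ∃ λ A → S A ≡ σ × V ⊆ A
  ⊆MaxSet⇒⊆S⁻¹ {σ} {V} (V₀ , SV₀≡σ) V⊆MaxSet =
    let A , SA≡σ , allFin⊆A = cover (allFin n) in A , SA≡σ , λ {x} → allFin⊆A (∈-allFin x)
    where
    cover-point : ∀ y → ∃ λ B → S B ≡ σ × (y ∈ V → y ∈ B)
    cover-point y with y ∈? V
    ... | no y∉V  = V₀ , SV₀≡σ , λ y∈V → contradiction y∈V y∉V
    ... | yes y∈V with V⊆MaxSet y∈V
    ...   | B , SB≡σ , y∈B = B , SB≡σ , λ _ → y∈B

    cover : (ys : List (Fin n)) → ∃ λ A → S A ≡ σ × (∀ {y} → y ∈ₗ ys → y ∈ V → y ∈ A)
    cover [] = V₀ , SV₀≡σ , λ ()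
    cover (y ∷ ys) with cover-point y | cover ys
    ... | B , SB≡σ , y∈B | A , SA≡σ , ys⊆A = B ∪ A , ∪-preserves-S SB≡σ SA≡σ , λ where
      (Any.here refl) y∈V → p⊆p∪q A (y∈B y∈V)
      (Any.there y∈ys) y∈V → q⊆p∪q B A (ys⊆A y∈ys y∈V)

  -- Sketch equality is undecidable, so a minimal subset is only found under double negation;
  -- this suffices below because membership in a subset is decidable.
  ¬¬-core⊆ : ∀ {σ} V → S V ≡ σ → ¬ ¬ (∃ λ C → C ⊆ V × IsCore M σ C)
  ¬¬-core⊆ V = go V (<-wellFounded ∣ V ∣)
    where
    go : ∀ {σ} V → Acc _<_ ∣ V ∣ → S V ≡ σ → ¬ ¬ (∃ λ C → C ⊆ V × IsCore M σ C)
    go {σ} V (acc rec) SV≡σ noCore = ¬¬-excluded-middle {A = ∃ λ U → U ⊂ V × S U ≡ σ} λ where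
      (yes (U , U⊂V , SU≡σ)) → go U (rec (p⊂q⇒∣p∣<∣q∣ U⊂V)) SU≡σ λ (C , C⊆U , C-core) →
        noCore (C , ⊆-trans C⊆U (proj₁ U⊂V) , C-core)
      (no ∄U⊂V) → noCore (V , ⊆-refl , SV≡σ , λ U U⊆V SU≡σ →
        p⊆q∧p⊄q⇒p≡q U⊆V (λ U⊂V → ∄U⊂V (U , U⊂V , SU≡σ)))

  uniqueCore⊆ : HasUniqueCores M → ∀ {σ C V} → IsCore M σ C → S V ≡ σ → C ⊆ V
  uniqueCore⊆ unique {σ} {C} {V} C-core SV≡σ {x} x∈C =
    decidable-stable (x ∈? V) λ x∉V → ¬¬-core⊆ V SV≡σ λ (C′ , C′⊆V , C′-core) →
      let _ , _ , ≡core = unique σ (V , SV≡σ)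
      in x∉V (C′⊆V (subst (x ∈_) (trans (≡core C C-core) (sym (≡core C′ C′-core))) x∈C))

mainTheorem14 : ∀ {n : ℕ} {Sk : Set} (M : ComposableMap n Sk)
    → HasUniqueCores M
    → ∀ σ₁ σ₂ → IsSketch M σ₁ → IsSketch M σ₂
    → _≻_ M σ₁ σ₂
    → ∀ C₁ C₂ → IsCore M σ₁ C₁ → IsCore M σ₂ C₂
    → ∀ x → x ∈ C₁ → MaxSet M σ₂ x → x ∈ C₂
mainTheorem14 {n} M unique _ _ σ₁-sketch _ σ₁≻σ₂ C₁ C₂ C₁-core (SC₂≡σ₂ , _) x x∈C₁ (V₂ , SV₂≡σ₂ , x∈V₂)
  with ⊆MaxSet⇒⊆S⁻¹ M σ₁-sketch (λ {y} y∈V₂ → σ₁≻σ₂ y (V₂ , SV₂≡σ₂ , y∈V₂))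
... | A , SA≡σ₁ , V₂⊆A = decidable-stable (x ∈? C₂) λ x∉C₂ → x∉W x∉C₂ (C₁⊆W x∈C₁)
  where
  W : Subset n
  W = (A ─ V₂) ∪ C₂

  C₁⊆W : C₁ ⊆ W
  C₁⊆W = uniqueCore⊆ M unique C₁-core
    (trans (S-replace M V₂⊆A (trans SV₂≡σ₂ (sym SC₂≡σ₂))) SA≡σ₁)

  x∉W : x ∉ C₂ → x ∉ W
  x∉W x∉C₂ = [ (λ x∈A─V₂ → x∈p─q⇒x∉q x∈A─V₂ x∈V₂) , x∉C₂ ]′ ∘ x∈p∪q⁻ (A ─ V₂) C₂
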